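{- Let $G_1$ be a graph containing a cut-edge and let $G_2$ be a graph disjoint from $G_1$. Then every vertex-edge-identification $(G_1,e_1,u_1)\odot_{VE}(G_2,e_2,u_2)$ contains a cut-edge.
   Context: Graphs are finite, loopless, parallel edges allowed. A cut-edge is an edge $f$ such that $\{f\}=E(V_1,V_2)$ for some partition $\{V_1,V_2\}$ of the vertex set, where $E(V_1,V_2)$ is the set of edges with one end in $V_1$ and the other in $V_2$. For disjoint $G_1,G_2$ and edges $e_i\in E(G_i)$ with end vertices $u_i,v_i$, $(G_1,e_1,u_1)\odot_{VE}(G_2,e_2,u_2)$ is obtained from $G_1\cup G_2$ by deleting $e_1,e_2$, identifying $v_1$ with $v_2$, and adding an edge between $u_1$ and $u_2$. -}

module Defs where

open import Data.Nat using (ℕ; suc; _+_)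
open import Data.Fin using (Fin; zero; suc; _↑ˡ_; _↑ʳ_; splitAt; punchIn; punchOut; _≟_)
open import Data.Bool using (Bool; true; false)
open import Data.Product using (Σ; ∃; _×_; _,_; proj₁; proj₂)
open import Data.Sum using (_⊎_; inj₁; inj₂)
open import Relation.Nullary using (¬_; yes; no)
open import Relation.Binary.PropositionalEquality using (_≡_; _≢_)

-- A (multi)graph with vertex set Fin n and edge set Fin m:
-- each edge is given by its ordered pair of end vertices.
-- Parallel edges are allowed (different edge indices may have the same ends).
Graph : ℕ → ℕ → Set
Graph n m = Fin m → Fin n × Fin n

Loopless : ∀ {n m} → Graph n m → Set
Loopless G = ∀ e → proj₁ (G e) ≢ proj₂ (G e)

HasEnds : ∀ {n m} → Graph n m → Fin m → Fin n → Fin n → Set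
HasEnds G e u v = (G e ≡ (u , v)) ⊎ (G e ≡ (v , u))

-- A bipartition {V1 , V2} of the vertex set is given by its indicator
-- side : Fin n → Bool  (V1 = side⁻¹ true, V2 = side⁻¹ false), both parts nonempty.
IsPartition : ∀ {n} → (Fin n → Bool) → Set
IsPartition {n} side = (Σ (Fin n) λ x → side x ≡ true) × (Σ (Fin n) λ y → side y ≡ false)

Crosses : ∀ {n m} → Graph n m → (Fin n → Bool) → Fin m → Set
Crosses G side e = side (proj₁ (G e)) ≢ side (proj₂ (G e))

IsCutEdge : ∀ {n m} → Graph n m → Fin m → Set
IsCutEdge {n} G f =
  Σ (Fin n → Bool) λ side →
    IsPartition side × Crosses G side f × (∀ e → Crosses G side e → e ≡ f)

HasCutEdge : ∀ {n m} → Graph n m → Set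
HasCutEdge {n} {m} G = Σ (Fin m) λ f → IsCutEdge G f

-- Vertex-edge identification (G1,e1,u1) ⊙VE (G2,e2,u2), where v1, v2 are the other ends.
-- Vertices: Fin (n1 + k), where G1's vertex i ↦ i ↑ˡ k, and G2's vertex w ≠ v2 ↦ n1 ↑ʳ punchOut,
-- while v2 ↦ v1 (identification).
-- Edges: Fin (suc (a + b)): zero is the new edge u1u2, then the edges of G1 other than e1
-- (via punchIn e1), then the edges of G2 other than e2 (via punchIn e2).
vertex₂ : ∀ n1 {k} → Fin n1 → Fin (suc k) → Fin (suc k) → Fin (n1 + k)
vertex₂ n1 {k} v1 v2 w with w ≟ v2
... | yes _ = v1 ↑ˡ k
... | no w≢v2 = n1 ↑ʳ punchOut {i = v2} {j = w} (λ eq → w≢v2 (Relation.Binary.PropositionalEquality.sym eq))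

mapPair : ∀ {A B : Set} → (A → B) → A × A → B × B
mapPair f (x , y) = f x , f y

VE : ∀ {n1 a k b} →
     (G1 : Graph n1 (suc a)) (e1 : Fin (suc a)) (u1 v1 : Fin n1) →
     (G2 : Graph (suc k) (suc b)) (e2 : Fin (suc b)) (u2 v2 : Fin (suc k)) →
     Graph (n1 + k) (suc (a + b))
VE {n1} {a} {k} G1 e1 u1 v1 G2 e2 u2 v2 zero = u1 ↑ˡ k , vertex₂ n1 v1 v2 u2
VE {n1} {a} {k} G1 e1 u1 v1 G2 e2 u2 v2 (suc x) with splitAt a x
... | inj₁ i = mapPair (_↑ˡ k) (G1 (punchIn e1 i))
... | inj₂ j = mapPair (vertex₂ n1 v1 v2) (G2 (punchIn e2 j))

module Submission where

-- Let f be a cut-edge of G1, witnessed by a 2-colouring `side`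
-- of V(G1) whose only bichromatic edge is f.  Colour H = (G1,e1,u1) ⊙VE
-- (G2,e2,u2) by keeping the colours of G1 and giving every vertex coming from
-- G2 the colour of v1 (the vertex v2 is glued onto).  Then
--   * edges of G2 are monochromatic,
--   * an edge of G1 other than e1 is bichromatic in H iff it is in G1,
--   * the new edge u1u2 is bichromatic iff side u1 ≢ side v1, i.e. iff e1 is
--     bichromatic in G1 (e1 has ends u1, v1).
-- So the bichromatic edges of H are exactly the images of those of G1 under
-- the edge map `liftEdge` (e1 ↦ u1u2, other edges of G1 ↦ themselves), and
-- the image of f is a cut-edge of H.

open import Defs
open import Data.Nat using (ℕ; suc; _+_)
open import Data.Fin using (Fin; zero; suc; _↑ˡ_; _↑ʳ_; splitAt; punchIn; punchOut; _≟_)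
open import Data.Fin.Properties using (splitAt-↑ˡ; splitAt-↑ʳ; splitAt⁻¹-↑ˡ; punchInᵢ≢i; punchOut-punchIn; punchIn-punchOut)
open import Data.Bool using (Bool)
open import Data.Product using (Σ; _×_; _,_; proj₁; proj₂)
open import Data.Sum using (inj₁; inj₂; [_,_]′)
open import Data.Empty using (⊥-elim)
open import Function using (_∘_)
open import Relation.Nullary using (¬_; yes; no)
open import Relation.Binary.PropositionalEquality using (_≡_; _≢_; refl; sym; trans; cong; subst)

-- A pair of vertices is separated by a colouring if its ends get different
-- colours; `Crosses G side e` is definitionally `Separates side (G e)`.
Separates : ∀ {n} → (Fin n → Bool) → Fin n × Fin n → Set
Separates side p = side (proj₁ p) ≢ side (proj₂ p)

module _ {n n′} (φ : Fin n → Fin n′) {side : Fin n → Bool} {side′ : Fin n′ → Bool} where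

  separates-preserve : (∀ x → side′ (φ x) ≡ side x) →
                       ∀ p → Separates side p → Separates side′ (mapPair φ p)
  separates-preserve agree (x , y) sep s = sep (trans (sym (agree x)) (trans s (agree y)))

  separates-reflect : (∀ x → side′ (φ x) ≡ side x) →
                      ∀ p → Separates side′ (mapPair φ p) → Separates side p
  separates-reflect agree (x , y) sep s = sep (trans (agree x) (trans s (sym (agree y))))

separates-constant : ∀ {n n′} (φ : Fin n → Fin n′) {side′ : Fin n′ → Bool} {c : Bool} →
                     (∀ x → side′ (φ x) ≡ c) → ∀ p → ¬ Separates side′ (mapPair φ p)
separates-constant φ const (x , y) sep = sep (trans (const x) (sym (const y)))

module _ {n m} {G : Graph n m} {e : Fin m} {u v : Fin n} (side : Fin n → Bool) where

  crosses⇒ends-separated : HasEnds G e u v → Crosses G side e → side u ≢ side v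
  crosses⇒ends-separated (inj₁ Ge≡uv) c = subst (Separates side) Ge≡uv c
  crosses⇒ends-separated (inj₂ Ge≡vu) c = subst (Separates side) Ge≡vu c ∘ sym

  ends-separated⇒crosses : HasEnds G e u v → side u ≢ side v → Crosses G side e
  ends-separated⇒crosses (inj₁ Ge≡uv) sep = subst (Separates side) (sym Ge≡uv) sep
  ends-separated⇒crosses (inj₂ Ge≡vu) sep = subst (Separates side) (sym Ge≡vu) (sep ∘ sym)

module Lifting {n1 a k b : ℕ}
    (G1 : Graph n1 (suc a)) (e1 : Fin (suc a)) (u1 v1 : Fin n1)
    (G2 : Graph (suc k) (suc b)) (e2 : Fin (suc b)) (u2 v2 : Fin (suc k))
    (side : Fin n1 → Bool) where

  H : Graph (n1 + k) (suc (a + b))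
  H = VE G1 e1 u1 v1 G2 e2 u2 v2

  extend : Fin (n1 + k) → Bool
  extend x = [ side , (λ _ → side v1) ]′ (splitAt n1 x)

  extend-left : ∀ i → extend (i ↑ˡ k) ≡ side i
  extend-left i rewrite splitAt-↑ˡ n1 i k = refl

  extend-right : ∀ w → extend (vertex₂ n1 v1 v2 w) ≡ side v1
  extend-right w with w ≟ v2
  ... | yes _ = extend-left v1
  ... | no w≢v2 rewrite splitAt-↑ʳ n1 k (punchOut {i = v2} {j = w} (w≢v2 ∘ sym)) = refl

  extend-partition : IsPartition side → IsPartition extend
  extend-partition ((x , x-true) , (y , y-false)) =
    (x ↑ˡ k , trans (extend-left x) x-true) , (y ↑ˡ k , trans (extend-left y) y-false)

  left-edge : ∀ i → H (suc (i ↑ˡ b)) ≡ mapPair (_↑ˡ k) (G1 (punchIn e1 i))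
  left-edge i rewrite splitAt-↑ˡ a i b = refl

  right-edge : ∀ j → H (suc (a ↑ʳ j)) ≡ mapPair (vertex₂ n1 v1 v2) (G2 (punchIn e2 j))
  right-edge j rewrite splitAt-↑ʳ a b j = refl

  liftEdge : Fin (suc a) → Fin (suc (a + b))
  liftEdge e with e ≟ e1
  ... | yes _ = zero
  ... | no e≢e1 = suc (punchOut (e≢e1 ∘ sym) ↑ˡ b)

  liftEdge-punchIn : ∀ i → liftEdge (punchIn e1 i) ≡ suc (i ↑ˡ b)
  liftEdge-punchIn i with punchIn e1 i ≟ e1
  ... | yes eq = ⊥-elim (punchInᵢ≢i e1 i eq)
  ... | no _ = cong (λ j → suc (j ↑ˡ b)) (punchOut-punchIn e1)

  module _ (ends : HasEnds G1 e1 u1 v1) where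

    newEdge-crosses : Crosses G1 side e1 → Crosses H extend zero
    newEdge-crosses c s = crosses⇒ends-separated {G = G1} {e = e1} side ends c (trans (sym (extend-left u1)) (trans s (extend-right u2)))

    newEdge-reflects : Crosses H extend zero → Crosses G1 side e1
    newEdge-reflects c = ends-separated⇒crosses {G = G1} {e = e1} side ends (λ s → c (trans (extend-left u1) (trans s (sym (extend-right u2)))))

    liftEdge-crosses : ∀ e → Crosses G1 side e → Crosses H extend (liftEdge e)
    liftEdge-crosses e c with e ≟ e1
    ... | yes refl = newEdge-crosses c
    ... | no e≢e1 =
      subst (Separates extend) (sym (left-edge i))
            (separates-preserve (_↑ˡ k) {side} {extend} extend-left (G1 (punchIn e1 i))
                                (subst (Crosses G1 side) (sym (punchIn-punchOut (e≢e1 ∘ sym))) c))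
      where i = punchOut (e≢e1 ∘ sym)

    -- Every crossing edge of H is the lift of a crossing edge of G1;
    -- edges of G2 never cross, since G2's vertices are monochromatic.
    crossing-from-G1 : ∀ x → Crosses H extend x → Σ (Fin (suc a)) λ e → Crosses G1 side e × liftEdge e ≡ x
    crossing-from-G1 zero c = e1 , newEdge-reflects c , liftEdge-e1
      where
        liftEdge-e1 : liftEdge e1 ≡ zero
        liftEdge-e1 with e1 ≟ e1
        ... | yes _ = refl
        ... | no e1≢e1 = ⊥-elim (e1≢e1 refl)
    crossing-from-G1 (suc x) c with splitAt a x in split≡
    ... | inj₁ i = punchIn e1 i
                 , separates-reflect (_↑ˡ k) {side} {extend} extend-left (G1 (punchIn e1 i)) c
                 , trans (liftEdge-punchIn i) (cong suc (splitAt⁻¹-↑ˡ split≡))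
    ... | inj₂ j = ⊥-elim (separates-constant (vertex₂ n1 v1 v2) {extend} extend-right (G2 (punchIn e2 j)) c)

cutEdge-lifts : ∀ {n1 a k b} →
    (G1 : Graph n1 (suc a)) (e1 : Fin (suc a)) (u1 v1 : Fin n1) →
    (G2 : Graph (suc k) (suc b)) (e2 : Fin (suc b)) (u2 v2 : Fin (suc k)) →
    HasEnds G1 e1 u1 v1 → (f : Fin (suc a)) (cut : IsCutEdge G1 f) →
    IsCutEdge (VE G1 e1 u1 v1 G2 e2 u2 v2) (Lifting.liftEdge G1 e1 u1 v1 G2 e2 u2 v2 (proj₁ cut) f)
cutEdge-lifts G1 e1 u1 v1 G2 e2 u2 v2 ends f (side , part , f-crosses , only-f) =
  extend , extend-partition part , liftEdge-crosses ends f f-crosses , only-lift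
  where
    open Lifting G1 e1 u1 v1 G2 e2 u2 v2 side

    only-lift : ∀ x → Crosses H extend x → x ≡ liftEdge f
    only-lift x c with crossing-from-G1 ends x c
    ... | e , e-crosses , lift-e≡x = trans (sym lift-e≡x) (cong liftEdge (only-f e e-crosses))

mainTheorem8 : ∀ {n1 a k b} →
    (G1 : Graph n1 (suc a)) (e1 : Fin (suc a)) (u1 v1 : Fin n1) →
    (G2 : Graph (suc k) (suc b)) (e2 : Fin (suc b)) (u2 v2 : Fin (suc k)) →
    Loopless G1 → Loopless G2 →
    HasEnds G1 e1 u1 v1 → HasEnds G2 e2 u2 v2 →
    HasCutEdge G1 →
    HasCutEdge (VE G1 e1 u1 v1 G2 e2 u2 v2)
mainTheorem8 G1 e1 u1 v1 G2 e2 u2 v2 _ _ ends _ (f , cut) =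
  Lifting.liftEdge G1 e1 u1 v1 G2 e2 u2 v2 (proj₁ cut) f ,
  cutEdge-lifts G1 e1 u1 v1 G2 e2 u2 v2 ends f cut
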